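{- Let $t\ge 2$ and $\lambda\ge 1$ be integers and let $D$ be a $(t,\lambda)$-liking digraph. If $t\ge\lambda+1$, or if $d^+(v)=t+\lambda-1$ for every vertex $v$ of $D$, then $d^+(v)=d^-(v)$ for every vertex $v$ of $D$.
   Context: All digraphs are finite and have no loops and no multiple arcs. A digraph $D$ is a $(t,\lambda)$-liking digraph if every set of $t$ distinct vertices of $D$ has exactly $\lambda$ common out-neighbors (the definition presumes $D$ has at least $t$ vertices). $d^+(v)$ and $d^-(v)$ denote the out-degree and in-degree of $v$. -}

module Defs where

open import Data.Nat using (ℕ; _≤_)
open import Data.Bool using (Bool; true; false; _∨_; not)
open import Data.Fin using (Fin)
open import Data.Fin.Subset using (Subset; ∣_∣; _∈_)
open import Data.Vec using (allFin; countᵇ; lookup)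
open import Data.Bool using (_∧_)
open import Data.Vec using (Vec; []; _∷_; map)
open import Data.Product using (_×_)
open import Relation.Binary.PropositionalEquality using (_≡_)

record Digraph (n : ℕ) : Set where
  field
    arc      : Fin n → Fin n → Bool
    loopless : ∀ v → arc v v ≡ false
open Digraph public

outdeg : ∀ {n} → Digraph n → Fin n → ℕ
outdeg D v = countᵇ (λ w → arc D v w) (allFin _)

indeg : ∀ {n} → Digraph n → Fin n → ℕ
indeg D v = countᵇ (λ u → arc D u v) (allFin _)

andV : ∀ {k} → Vec Bool k → Bool
andV [] = true
andV (b ∷ bs) = b ∧ andV bs

isCommonOut : ∀ {n} → Digraph n → Subset n → Fin n → Bool
isCommonOut D S w = andV (map (λ v → not (lookup S v) ∨ arc D v w) (allFin _))

commonOut : ∀ {n} → Digraph n → Subset n → ℕ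
commonOut D S = countᵇ (isCommonOut D S) (allFin _)

Liking : ∀ {n} → ℕ → ℕ → Digraph n → Set
Liking {n} t λ' D = (t ≤ n) × (∀ (S : Subset n) → ∣ S ∣ ≡ t → commonOut D S ≡ λ')

-- Write t = s + 1. A set A of at most s out-neighbours of v extends, together with v,
-- to a t-set, whose λ common out-neighbours are out-neighbours of v outside A; so
-- λ + |A| ≤ d, and taking |A| = min(s, d) gives d ≥ s + λ as λ ≥ 1. For an s-set U of
-- in-neighbours of v, the common out-neighbourhood of U ∪ {v} is a λ-set of
-- out-neighbours of v, and U ↦ N⁺(U ∪ {v}) is injective: if U ≠ U′ have the same image,
-- then for x ∈ U′ ∖ U the t-set U ∪ {x} has that whole image and v as common
-- out-neighbours, more than λ. So the in-degree k satisfies C(k,s) ≤ C(d,λ). Either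
-- hypothesis gives C(d,λ) ≤ C(d,s) (unimodality if λ ≤ s ≤ d − λ, symmetry if
-- d = s + λ), hence k ≤ d at every vertex, and since in- and out-degrees have the same
-- sum, k = d everywhere.
module Submission where

open import Defs
open import Data.Bool.Base using (Bool; true; false; not; _∨_; if_then_else_)
open import Data.Bool.Properties using () renaming (_≟_ to _≟ᵇ_)
open import Data.Fin.Base using (Fin; zero; suc)
open import Data.Fin.Properties using (injective⇒≤)
open import Data.Fin.Subset
open import Data.Fin.Subset.Properties
open import Data.List.Base using (List; []; _∷_; [_]; _++_; map; length)
import Data.List.Base as List
open import Data.List.Properties using (length-map; length-++)
open import Data.List.Membership.Propositional using () renaming (_∈_ to _∈ₗ_)
open import Data.List.Membership.Propositional.Properties
  using (∈-lookup; ∈-map⁺; ∈-map⁻; ∈-++⁺ˡ; ∈-++⁺ʳ; ∈-++⁻)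
open import Data.List.Membership.Setoid.Properties using (index-injective)
open import Data.List.Relation.Unary.All as All using ([])
open import Data.List.Relation.Unary.AllPairs using ([]; _∷_)
open import Data.List.Relation.Unary.Any as Any using (here)
open import Data.List.Relation.Unary.Unique.Propositional using (Unique)
open import Data.List.Relation.Unary.Unique.Propositional.Properties using (map⁺; ++⁺)
open import Data.Nat.Base using (ℕ; zero; suc; _+_; _∸_; _≤_; _<_; _≤′_; ≤′-refl; ≤′-step; s≤s; z≤n)
open import Data.Nat.Combinatorics using (_C_; nCk≡nC[n∸k]; nCk+nC[k+1]≡[n+1]C[k+1])
open import Data.Nat.Properties
open import Algebra.Properties.CommutativeMonoid.Sum +-0-commutativeMonoid
  using (sum; sum-syntax; ∑-comm; sum-cong-≗)
open import Data.Product.Base using (∃-syntax; _×_; _,_; proj₁; proj₂)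
open import Data.Sum.Base using (_⊎_; inj₁; inj₂)
open import Data.Vec.Base using ([]; _∷_; here; there; tabulate; lookup; countᵇ)
import Data.Vec.Base as Vec
open import Data.Vec.Properties using (lookup∘tabulate; []=⇒lookup; lookup⇒[]=; ∷-injectiveʳ; ≡-dec)
open import Function.Base using (id; _∘_)
open import Relation.Binary.PropositionalEquality
  using (_≡_; _≢_; refl; sym; trans; cong; cong₂; subst; subst₂; setoid; module ≡-Reasoning)
open import Relation.Nullary.Decidable.Core using (yes; no)
open import Relation.Nullary.Negation using (¬_; contradiction)

-- Binomial coefficients

k≤n⇒0<nCk : ∀ {n k} → k ≤ n → 0 < n C k
k≤n⇒0<nCk {n}     {zero}  _         = s≤s z≤n
k≤n⇒0<nCk {suc n} {suc k} (s≤s k≤n) = begin-strict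
  0                  <⟨ k≤n⇒0<nCk k≤n ⟩
  n C k              ≤⟨ m≤m+n (n C k) (n C suc k) ⟩
  n C k + n C suc k  ≡⟨ nCk+nC[k+1]≡[n+1]C[k+1] n k ⟩
  suc n C suc k      ∎
  where open ≤-Reasoning

nCk≤[n+1]Ck : ∀ n k → n C k ≤ suc n C k
nCk≤[n+1]Ck n zero    = ≤-refl
nCk≤[n+1]Ck n (suc k) = begin
  n C suc k          ≤⟨ m≤n+m (n C suc k) (n C k) ⟩
  n C k + n C suc k  ≡⟨ nCk+nC[k+1]≡[n+1]C[k+1] n k ⟩
  suc n C suc k      ∎
  where open ≤-Reasoning

C-monoˡ-≤ : ∀ {m n} k → m ≤ n → m C k ≤ n C k
C-monoˡ-≤ {m} k m≤n = go (≤⇒≤′ m≤n)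
  where
  go : ∀ {n} → m ≤′ n → m C k ≤ n C k
  go ≤′-refl        = ≤-refl
  go (≤′-step m≤′n) = ≤-trans (go m≤′n) (nCk≤[n+1]Ck _ k)

C-monoˡ-< : ∀ {m n k} → 0 < k → k ≤ suc m → m < n → m C k < n C k
C-monoˡ-< {m} {n} {suc k} _ (s≤s k≤m) m<n = begin-strict
  m C suc k          <⟨ +-monoˡ-< (m C suc k) (k≤n⇒0<nCk k≤m) ⟩
  m C k + m C suc k  ≡⟨ nCk+nC[k+1]≡[n+1]C[k+1] m k ⟩
  suc m C suc k      ≤⟨ C-monoˡ-≤ (suc k) m<n ⟩
  n C suc k          ∎
  where open ≤-Reasoning

[k+m]Ck≡[k+m]Cm : ∀ k m → (k + m) C k ≡ (k + m) C m
[k+m]Ck≡[k+m]Cm k m = trans (nCk≡nC[n∸k] (m≤m+n k m)) (cong ((k + m) C_) (m+n∸m≡n k m))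

-- If k + m < n, both sides split by Pascal's rule into pairs that again satisfy the
-- hypotheses for n - 1; the boundary case k + m = n is the symmetry of C.
k≤m∧k+m≤n⇒nCk≤nCm : ∀ {n k m} → k ≤ m → k + m ≤ n → n C k ≤ n C m
k≤m∧k+m≤n⇒nCk≤nCm {n} {k} {m} k≤m k+m≤n with m≤n⇒m<n∨m≡n k+m≤n
... | inj₂ refl = ≤-reflexive ([k+m]Ck≡[k+m]Cm k m)
k≤m∧k+m≤n⇒nCk≤nCm {suc n} {zero} {m} _ _ | inj₁ (s≤s m≤n) = k≤n⇒0<nCk (m≤n⇒m≤1+n m≤n)
k≤m∧k+m≤n⇒nCk≤nCm {suc n} {suc k} {suc m} (s≤s k≤m) _ | inj₁ (s≤s k+m+2≤n) = begin
  suc n C suc k      ≡⟨ nCk+nC[k+1]≡[n+1]C[k+1] n k ⟨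
  n C k + n C suc k  ≤⟨ +-mono-≤ (k≤m∧k+m≤n⇒nCk≤nCm k≤m k+m≤n)
                                 (k≤m∧k+m≤n⇒nCk≤nCm (s≤s k≤m) k+m+2≤n) ⟩
  n C m + n C suc m  ≡⟨ nCk+nC[k+1]≡[n+1]C[k+1] n m ⟩
  suc n C suc m      ∎
  where
  open ≤-Reasoning
  k+m≤n : k + m ≤ n
  k+m≤n = ≤-trans (+-mono-≤ (n≤1+n k) (n≤1+n m)) k+m+2≤n

-- Sums

∑-mono-≤ : ∀ {n} {f g : Fin n → ℕ} → (∀ i → f i ≤ g i) → sum f ≤ sum g
∑-mono-≤ {zero}  f≤g = z≤n
∑-mono-≤ {suc n} f≤g = +-mono-≤ (f≤g zero) (∑-mono-≤ (f≤g ∘ suc))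

≤∧≤∧+≡+⇒≡∧≡ : ∀ {a b c d} → a ≤ b → c ≤ d → a + c ≡ b + d → a ≡ b × c ≡ d
≤∧≤∧+≡+⇒≡∧≡ {a} {b} {c} {d} a≤b c≤d a+c≡b+d =
  a≡b , +-cancelˡ-≡ a c d (trans a+c≡b+d (cong (_+ d) (sym a≡b)))
  where
  a≡b : a ≡ b
  a≡b = ≤-antisym a≤b (+-cancelʳ-≤ d b a (≤-trans (≤-reflexive (sym a+c≡b+d)) (+-monoʳ-≤ a c≤d)))

∑-≤∧≡⇒≗ : ∀ {n} {f g : Fin n → ℕ} → (∀ i → f i ≤ g i) → sum f ≡ sum g → ∀ i → f i ≡ g i
∑-≤∧≡⇒≗ {suc n} f≤g ∑f≡∑g i with ≤∧≤∧+≡+⇒≡∧≡ (f≤g zero) (∑-mono-≤ (f≤g ∘ suc)) ∑f≡∑g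
∑-≤∧≡⇒≗ {suc n} f≤g ∑f≡∑g zero    | f₀≡g₀ , _      = f₀≡g₀
∑-≤∧≡⇒≗ {suc n} f≤g ∑f≡∑g (suc i) | _ , ∑f′≡∑g′ = ∑-≤∧≡⇒≗ (f≤g ∘ suc) ∑f′≡∑g′ i

-- Subsets of Fin n

x∈tabulate⁺ : ∀ {n} {f : Fin n → Bool} {x} → f x ≡ true → x ∈ tabulate f
x∈tabulate⁺ {f = f} {x} fx = lookup⇒[]= x (tabulate f) (trans (lookup∘tabulate f x) fx)

x∈tabulate⁻ : ∀ {n} {f : Fin n → Bool} {x} → x ∈ tabulate f → f x ≡ true
x∈tabulate⁻ {f = f} {x} x∈ = trans (sym (lookup∘tabulate f x)) ([]=⇒lookup x∈)

countᵇ-tabulate : ∀ {A : Set} {n} (f : A → Bool) (g : Fin n → A) →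
                  countᵇ f (tabulate g) ≡ ∣ tabulate (f ∘ g) ∣
countᵇ-tabulate {n = zero}  f g = refl
countᵇ-tabulate {n = suc n} f g with f (g zero)
... | true  = cong suc (countᵇ-tabulate f (g ∘ suc))
... | false = countᵇ-tabulate f (g ∘ suc)

∣tabulate∣≡∑ : ∀ {n} (f : Fin n → Bool) → ∣ tabulate f ∣ ≡ ∑[ i < n ] (if f i then 1 else 0)
∣tabulate∣≡∑ {zero}  f = refl
∣tabulate∣≡∑ {suc n} f with f zero
... | true  = cong suc (∣tabulate∣≡∑ (f ∘ suc))
... | false = ∣tabulate∣≡∑ (f ∘ suc)

∣p∪q∣≡∣p∣+∣q∣ : ∀ {n} (p q : Subset n) → Empty (p ∩ q) → ∣ p ∪ q ∣ ≡ ∣ p ∣ + ∣ q ∣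
∣p∪q∣≡∣p∣+∣q∣ []            []            _     = refl
∣p∪q∣≡∣p∣+∣q∣ (inside  ∷ p) (inside  ∷ q) p∩q≡∅ = contradiction (zero , here) p∩q≡∅
∣p∪q∣≡∣p∣+∣q∣ (inside  ∷ p) (outside ∷ q) p∩q≡∅ =
  cong suc (∣p∪q∣≡∣p∣+∣q∣ p q (drop-∷-Empty p∩q≡∅))
∣p∪q∣≡∣p∣+∣q∣ (outside ∷ p) (inside  ∷ q) p∩q≡∅ =
  trans (cong suc (∣p∪q∣≡∣p∣+∣q∣ p q (drop-∷-Empty p∩q≡∅))) (sym (+-suc ∣ p ∣ ∣ q ∣))
∣p∪q∣≡∣p∣+∣q∣ (outside ∷ p) (outside ∷ q) p∩q≡∅ = ∣p∪q∣≡∣p∣+∣q∣ p q (drop-∷-Empty p∩q≡∅)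

x∉p⇒∣p∪⁅x⁆∣≡1+∣p∣ : ∀ {n} {x : Fin n} {p} → x ∉ p → ∣ p ∪ ⁅ x ⁆ ∣ ≡ suc ∣ p ∣
x∉p⇒∣p∪⁅x⁆∣≡1+∣p∣ {x = x} {p} x∉p = begin
  ∣ p ∪ ⁅ x ⁆ ∣      ≡⟨ ∣p∪q∣≡∣p∣+∣q∣ p ⁅ x ⁆ p∩⁅x⁆≡∅ ⟩
  ∣ p ∣ + ∣ ⁅ x ⁆ ∣  ≡⟨ cong (∣ p ∣ +_) (∣⁅x⁆∣≡1 x) ⟩
  ∣ p ∣ + 1          ≡⟨ +-comm ∣ p ∣ 1 ⟩
  suc ∣ p ∣          ∎
  where
  open ≡-Reasoning
  p∩⁅x⁆≡∅ : Empty (p ∩ ⁅ x ⁆)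
  p∩⁅x⁆≡∅ (y , y∈p∩⁅x⁆) with x∈p∩q⁻ p ⁅ x ⁆ y∈p∩⁅x⁆
  ... | y∈p , y∈⁅x⁆ rewrite x∈⁅y⁆⇒x≡y x y∈⁅x⁆ = x∉p y∈p

Lift-∪⁅⁆ : ∀ {n} {P : Fin n → Set} p x → Lift P p → P x → Lift P (p ∪ ⁅ x ⁆)
Lift-∪⁅⁆ p x Pp Px u∈ with x∈p∪q⁻ p ⁅ x ⁆ u∈
... | inj₁ u∈p   = Pp u∈p
... | inj₂ u∈⁅x⁆ rewrite x∈⁅y⁆⇒x≡y x u∈⁅x⁆ = Px

⊆-interpolate : ∀ {n} {p q : Subset n} {j} → p ⊆ q → ∣ p ∣ ≤ j → j ≤ ∣ q ∣ →
                ∃[ r ] p ⊆ r × r ⊆ q × ∣ r ∣ ≡ j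
⊆-interpolate {p = []}          {[]}          p⊆q z≤n z≤n = [] , p⊆q , p⊆q , refl
⊆-interpolate {p = inside  ∷ p} {outside ∷ q} p⊆q _ _ = contradiction (p⊆q here) λ ()
⊆-interpolate {p = inside  ∷ p} {inside  ∷ q} p⊆q (s≤s ∣p∣≤j) (s≤s j≤∣q∣) =
  let r , p⊆r , r⊆q , ∣r∣≡j = ⊆-interpolate (drop-∷-⊆ p⊆q) ∣p∣≤j j≤∣q∣
  in inside ∷ r , in⊆in p⊆r , in⊆in r⊆q , cong suc ∣r∣≡j
⊆-interpolate {p = outside ∷ p} {outside ∷ q} p⊆q ∣p∣≤j j≤∣q∣ =
  let r , p⊆r , r⊆q , ∣r∣≡j = ⊆-interpolate (drop-∷-⊆ p⊆q) ∣p∣≤j j≤∣q∣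
  in outside ∷ r , s⊆s p⊆r , s⊆s r⊆q , ∣r∣≡j
⊆-interpolate {p = outside ∷ p} {inside  ∷ q} p⊆q ∣p∣≤j j≤1+∣q∣ with m≤n⇒m<n∨m≡n j≤1+∣q∣
... | inj₁ (s≤s j≤∣q∣) =
  let r , p⊆r , r⊆q , ∣r∣≡j = ⊆-interpolate (drop-∷-⊆ p⊆q) ∣p∣≤j j≤∣q∣
  in outside ∷ r , s⊆s p⊆r , out⊆ r⊆q , ∣r∣≡j
... | inj₂ j≡1+∣q∣ = inside ∷ q , p⊆q , ⊆-refl , sym j≡1+∣q∣

superset-of-size : ∀ {n} {p : Subset n} {j} → ∣ p ∣ ≤ j → j ≤ n → ∃[ r ] p ⊆ r × ∣ r ∣ ≡ j
superset-of-size {n} ∣p∣≤j j≤n =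
  let r , p⊆r , _ , ∣r∣≡j = ⊆-interpolate ⊆⊤ ∣p∣≤j (≤-trans j≤n (≤-reflexive (sym (∣⊤∣≡n n))))
  in r , p⊆r , ∣r∣≡j

subset-of-size : ∀ {n} {q : Subset n} {j} → j ≤ ∣ q ∣ → ∃[ r ] r ⊆ q × ∣ r ∣ ≡ j
subset-of-size {n} j≤∣q∣ =
  let r , _ , r⊆q , ∣r∣≡j = ⊆-interpolate (⊆-min _) (≤-trans (≤-reflexive (∣⊥∣≡0 n)) z≤n) j≤∣q∣
  in r , r⊆q , ∣r∣≡j

there-∉ : ∀ {n} {p q : Subset n} {s t} → ∃[ x ] x ∈ q × x ∉ p → ∃[ x ] x ∈ t ∷ q × x ∉ s ∷ p
there-∉ (x , x∈q , x∉p) = suc x , there x∈q , x∉p ∘ drop-there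

∣p∣≤∣q∣∧p≢q⇒∃[x∈q∖p] : ∀ {n} {p q : Subset n} → ∣ p ∣ ≤ ∣ q ∣ → p ≢ q → ∃[ x ] x ∈ q × x ∉ p
∣p∣≤∣q∣∧p≢q⇒∃[x∈q∖p] {p = []}          {[]}          _ p≢q = contradiction refl p≢q
∣p∣≤∣q∣∧p≢q⇒∃[x∈q∖p] {p = outside ∷ p} {inside  ∷ q} _ _   = zero , here , λ ()
∣p∣≤∣q∣∧p≢q⇒∃[x∈q∖p] {p = outside ∷ p} {outside ∷ q} ∣p∣≤∣q∣ p≢q =
  there-∉ (∣p∣≤∣q∣∧p≢q⇒∃[x∈q∖p] ∣p∣≤∣q∣ (p≢q ∘ cong (outside ∷_)))
∣p∣≤∣q∣∧p≢q⇒∃[x∈q∖p] {p = inside  ∷ p} {inside  ∷ q} (s≤s ∣p∣≤∣q∣) p≢q =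
  there-∉ (∣p∣≤∣q∣∧p≢q⇒∃[x∈q∖p] ∣p∣≤∣q∣ (p≢q ∘ cong (inside ∷_)))
∣p∣≤∣q∣∧p≢q⇒∃[x∈q∖p] {p = inside  ∷ p} {outside ∷ q} ∣p∣<∣q∣ _ =
  there-∉ (∣p∣≤∣q∣∧p≢q⇒∃[x∈q∖p] (<⇒≤ ∣p∣<∣q∣) λ { refl → <-irrefl refl ∣p∣<∣q∣ })

-- Counting subsets of a given size

Unique-lookup-injective : ∀ {A : Set} {xs : List A} → Unique xs →
                          ∀ {i j} → List.lookup xs i ≡ List.lookup xs j → i ≡ j
Unique-lookup-injective (_    ∷ _)    {zero}  {zero}  _     = refl
Unique-lookup-injective (x∉xs ∷ _)    {zero}  {suc j} x≡xⱼ  =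
  contradiction x≡xⱼ (All.lookup x∉xs (∈-lookup j))
Unique-lookup-injective (x∉xs ∷ _)    {suc i} {zero}  xᵢ≡x  =
  contradiction (sym xᵢ≡x) (All.lookup x∉xs (∈-lookup i))
Unique-lookup-injective (_    ∷ uniq) {suc i} {suc j} xᵢ≡xⱼ =
  cong suc (Unique-lookup-injective uniq xᵢ≡xⱼ)

length-≤-of-injection : ∀ {A B : Set} (f : A → B) {xs : List A} {ys : List B} → Unique xs →
                        (∀ {x} → x ∈ₗ xs → f x ∈ₗ ys) →
                        (∀ {x y} → x ∈ₗ xs → y ∈ₗ xs → f x ≡ f y → x ≡ y) →
                        length xs ≤ length ys
length-≤-of-injection {B = B} f {xs} {ys} uniq into inj = injective⇒≤ position-injective
  where
  position : Fin (length xs) → Fin (length ys)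
  position i = Any.index (into (∈-lookup i))
  position-injective : ∀ {i j} → position i ≡ position j → i ≡ j
  position-injective {i} {j} same =
    Unique-lookup-injective uniq (inj (∈-lookup i) (∈-lookup j)
      (index-injective (setoid B) (into (∈-lookup i)) (into (∈-lookup j)) same))

Choose : ∀ {n} → Subset n → ℕ → Subset n → Set
Choose p j r = r ⊆ p × ∣ r ∣ ≡ j

choose : ∀ {n} → Subset n → ℕ → List (Subset n)
choose []            zero    = [ [] ]
choose []            (suc j) = []
choose (outside ∷ p) j       = map (outside ∷_) (choose p j)
choose (inside  ∷ p) zero    = map (outside ∷_) (choose p zero)
choose (inside  ∷ p) (suc j) = map (inside ∷_) (choose p j) ++ map (outside ∷_) (choose p (suc j))

length-choose : ∀ {n} (p : Subset n) j → length (choose p j) ≡ ∣ p ∣ C j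
length-choose []            zero    = refl
length-choose []            (suc j) = refl
length-choose (outside ∷ p) j       = trans (length-map _ (choose p j)) (length-choose p j)
length-choose (inside  ∷ p) zero    = trans (length-map _ (choose p zero)) (length-choose p zero)
length-choose (inside  ∷ p) (suc j) = begin
  length (map (inside ∷_) (choose p j) ++ map (outside ∷_) (choose p (suc j)))
    ≡⟨ length-++ (map (inside ∷_) (choose p j)) ⟩
  length (map (inside ∷_) (choose p j)) + length (map (outside ∷_) (choose p (suc j)))
    ≡⟨ cong₂ _+_ (length-map _ (choose p j)) (length-map _ (choose p (suc j))) ⟩
  length (choose p j) + length (choose p (suc j))
    ≡⟨ cong₂ _+_ (length-choose p j) (length-choose p (suc j)) ⟩
  ∣ p ∣ C j + ∣ p ∣ C suc j
    ≡⟨ nCk+nC[k+1]≡[n+1]C[k+1] ∣ p ∣ j ⟩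
  suc ∣ p ∣ C suc j
    ∎
  where open ≡-Reasoning

∈-choose⁺ : ∀ {n} {p r : Subset n} {j} → Choose p j r → r ∈ₗ choose p j
∈-choose⁺ {p = []}          {[]}          {zero}  _             = here refl
∈-choose⁺ {p = outside ∷ p} {outside ∷ r}         (r⊆p , ∣r∣≡j) =
  ∈-map⁺ (outside ∷_) (∈-choose⁺ (drop-∷-⊆ r⊆p , ∣r∣≡j))
∈-choose⁺ {p = outside ∷ p} {inside  ∷ r}         (r⊆p , _)     = contradiction (r⊆p here) λ ()
∈-choose⁺ {p = inside  ∷ p} {outside ∷ r} {zero}  (r⊆p , ∣r∣≡j) =
  ∈-map⁺ (outside ∷_) (∈-choose⁺ (drop-∷-⊆ r⊆p , ∣r∣≡j))
∈-choose⁺ {p = inside  ∷ p} {outside ∷ r} {suc j} (r⊆p , ∣r∣≡j) =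
  ∈-++⁺ʳ (map (inside ∷_) (choose p j)) (∈-map⁺ (outside ∷_) (∈-choose⁺ (drop-∷-⊆ r⊆p , ∣r∣≡j)))
∈-choose⁺ {p = inside  ∷ p} {inside  ∷ r} {suc j} (r⊆p , ∣r∣≡j) =
  ∈-++⁺ˡ (∈-map⁺ (inside ∷_) (∈-choose⁺ (drop-∷-⊆ r⊆p , suc-injective ∣r∣≡j)))

∈-choose⁻ : ∀ {n} (p : Subset n) j {r} → r ∈ₗ choose p j → Choose p j r
∈-choose⁻ []            zero    (here refl) = (λ ()) , refl
∈-choose⁻ (outside ∷ p) j       r∈ with ∈-map⁻ (outside ∷_) r∈
... | r , r∈′ , refl = let r⊆p , ∣r∣≡j = ∈-choose⁻ p j r∈′ in s⊆s r⊆p , ∣r∣≡j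
∈-choose⁻ (inside  ∷ p) zero    r∈ with ∈-map⁻ (outside ∷_) r∈
... | r , r∈′ , refl = let r⊆p , ∣r∣≡j = ∈-choose⁻ p zero r∈′ in out⊆ r⊆p , ∣r∣≡j
∈-choose⁻ (inside  ∷ p) (suc j) r∈ with ∈-++⁻ (map (inside ∷_) (choose p j)) r∈
... | inj₁ r∈ˡ with ∈-map⁻ (inside ∷_) r∈ˡ
...   | r , r∈′ , refl = let r⊆p , ∣r∣≡j = ∈-choose⁻ p j r∈′ in in⊆in r⊆p , cong suc ∣r∣≡j
∈-choose⁻ (inside  ∷ p) (suc j) r∈ | inj₂ r∈ʳ with ∈-map⁻ (outside ∷_) r∈ʳ
...   | r , r∈′ , refl = let r⊆p , ∣r∣≡j = ∈-choose⁻ p (suc j) r∈′ in out⊆ r⊆p , ∣r∣≡j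

choose-unique : ∀ {n} (p : Subset n) j → Unique (choose p j)
choose-unique []            zero    = [] ∷ []
choose-unique []            (suc j) = []
choose-unique (outside ∷ p) j       = map⁺ ∷-injectiveʳ (choose-unique p j)
choose-unique (inside  ∷ p) zero    = map⁺ ∷-injectiveʳ (choose-unique p zero)
choose-unique (inside  ∷ p) (suc j) =
  ++⁺ (map⁺ ∷-injectiveʳ (choose-unique p j)) (map⁺ ∷-injectiveʳ (choose-unique p (suc j)))
      heads-differ
  where
  heads-differ : ∀ {r} → ¬ (r ∈ₗ map (inside ∷_) (choose p j) ×
                            r ∈ₗ map (outside ∷_) (choose p (suc j)))
  heads-differ (r∈ˡ , r∈ʳ) with ∈-map⁻ (inside ∷_) r∈ˡ | ∈-map⁻ (outside ∷_) r∈ʳ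
  ... | _ , _ , refl | _ , _ , ()

∣p∣Cj≤∣q∣Ck : ∀ {m n} (f : Subset m → Subset n) {p : Subset m} {q : Subset n} {j k} →
              (∀ {r} → Choose p j r → Choose q k (f r)) →
              (∀ {r r′} → Choose p j r → Choose p j r′ → f r ≡ f r′ → r ≡ r′) →
              ∣ p ∣ C j ≤ ∣ q ∣ C k
∣p∣Cj≤∣q∣Ck f {p} {q} {j} {k} into inj =
  subst₂ _≤_ (length-choose p j) (length-choose q k)
    (length-≤-of-injection f (choose-unique p j)
      (λ r∈ → ∈-choose⁺ (into (∈-choose⁻ p j r∈)))
      (λ r∈ r′∈ → inj (∈-choose⁻ p j r∈) (∈-choose⁻ p j r′∈)))

-- Neighbourhoods in a digraph

andV-map-tabulate⁻ : ∀ {A : Set} {n} (g : A → Bool) (h : Fin n → A) →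
                     andV (Vec.map g (tabulate h)) ≡ true → ∀ i → g (h i) ≡ true
andV-map-tabulate⁻ {n = suc n} g h all-true i with g (h zero) in g₀
andV-map-tabulate⁻ g h all-true zero    | true = g₀
andV-map-tabulate⁻ g h all-true (suc i) | true = andV-map-tabulate⁻ g (h ∘ suc) all-true i

andV-map-tabulate⁺ : ∀ {A : Set} {n} (g : A → Bool) (h : Fin n → A) →
                     (∀ i → g (h i) ≡ true) → andV (Vec.map g (tabulate h)) ≡ true
andV-map-tabulate⁺ {n = zero}  g h all-true = refl
andV-map-tabulate⁺ {n = suc n} g h all-true rewrite all-true zero =
  andV-map-tabulate⁺ g (h ∘ suc) (all-true ∘ suc)

module _ {n} (D : Digraph n) where

  outNbrs : Fin n → Subset n
  outNbrs v = tabulate (arc D v)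

  inNbrs : Fin n → Subset n
  inNbrs v = tabulate (λ u → arc D u v)

  commonOutNbrs : Subset n → Subset n
  commonOutNbrs S = tabulate (isCommonOut D S)

  outdeg≡∣outNbrs∣ : ∀ v → outdeg D v ≡ ∣ outNbrs v ∣
  outdeg≡∣outNbrs∣ v = countᵇ-tabulate (arc D v) id

  indeg≡∣inNbrs∣ : ∀ v → indeg D v ≡ ∣ inNbrs v ∣
  indeg≡∣inNbrs∣ v = countᵇ-tabulate (λ u → arc D u v) id

  commonOut≡∣commonOutNbrs∣ : ∀ S → commonOut D S ≡ ∣ commonOutNbrs S ∣
  commonOut≡∣commonOutNbrs∣ S = countᵇ-tabulate (isCommonOut D S) id

  ∈-commonOutNbrs⁻ : ∀ {S w u} → w ∈ commonOutNbrs S → u ∈ S → arc D u w ≡ true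
  ∈-commonOutNbrs⁻ {S} {w} {u} w∈ u∈S =
    subst (λ b → (not b ∨ arc D u w) ≡ true) ([]=⇒lookup u∈S)
          (andV-map-tabulate⁻ (λ u → not (lookup S u) ∨ arc D u w) id (x∈tabulate⁻ w∈) u)

  ∈-commonOutNbrs⁺ : ∀ {S w} → Lift (λ u → arc D u w ≡ true) S → w ∈ commonOutNbrs S
  ∈-commonOutNbrs⁺ {S} {w} arcs-to-w = x∈tabulate⁺ (andV-map-tabulate⁺ _ id arc-or-outside)
    where
    arc-or-outside : ∀ u → (not (lookup S u) ∨ arc D u w) ≡ true
    arc-or-outside u with lookup S u in S[u]
    ... | true  = arcs-to-w (lookup⇒[]= u S S[u])
    ... | false = refl

  no-loop : ∀ {u} → arc D u u ≢ true
  no-loop {u} uu = contradiction (trans (sym uu) (loopless D u)) λ ()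

  ∈⇒∉commonOutNbrs : ∀ {S u} → u ∈ S → u ∉ commonOutNbrs S
  ∈⇒∉commonOutNbrs u∈S u∈C = no-loop (∈-commonOutNbrs⁻ u∈C u∈S)

  commonOutNbrs⊆outNbrs : ∀ {S v} → v ∈ S → commonOutNbrs S ⊆ outNbrs v
  commonOutNbrs⊆outNbrs v∈S w∈C = x∈tabulate⁺ (∈-commonOutNbrs⁻ w∈C v∈S)

  v∉outNbrs : ∀ v → v ∉ outNbrs v
  v∉outNbrs v = no-loop ∘ x∈tabulate⁻

  v∉inNbrs : ∀ v → v ∉ inNbrs v
  v∉inNbrs v = no-loop ∘ x∈tabulate⁻

  ∑outdeg≡∑indeg : ∑[ v < n ] ∣ outNbrs v ∣ ≡ ∑[ v < n ] ∣ inNbrs v ∣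
  ∑outdeg≡∑indeg = begin
    ∑[ v < n ] ∣ outNbrs v ∣           ≡⟨ sum-cong-≗ (∣tabulate∣≡∑ ∘ arc D) ⟩
    ∑[ v < n ] ∑[ w < n ] [ v ⟶ w ]  ≡⟨ ∑-comm (λ v w → [ v ⟶ w ]) ⟩
    ∑[ w < n ] ∑[ v < n ] [ v ⟶ w ]  ≡⟨ sum-cong-≗ (λ w → ∣tabulate∣≡∑ (λ v → arc D v w)) ⟨
    ∑[ w < n ] ∣ inNbrs w ∣            ∎
    where
    open ≡-Reasoning
    [_⟶_] : Fin n → Fin n → ℕ
    [ v ⟶ w ] = if arc D v w then 1 else 0

  indeg≤outdeg⇒outdeg≡indeg : (∀ v → ∣ inNbrs v ∣ ≤ ∣ outNbrs v ∣) → ∀ v → outdeg D v ≡ indeg D v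
  indeg≤outdeg⇒outdeg≡indeg in≤out v = begin
    outdeg D v     ≡⟨ outdeg≡∣outNbrs∣ v ⟩
    ∣ outNbrs v ∣  ≡⟨ ∑-≤∧≡⇒≗ in≤out (sym ∑outdeg≡∑indeg) v ⟨
    ∣ inNbrs v ∣   ≡⟨ indeg≡∣inNbrs∣ v ⟨
    indeg D v      ∎
    where open ≡-Reasoning

  ∣commonOutNbrs∣+∣A∣≤outdeg : ∀ {v A S} → A ⊆ outNbrs v → A ∪ ⁅ v ⁆ ⊆ S →
                               ∣ commonOutNbrs S ∣ + ∣ A ∣ ≤ ∣ outNbrs v ∣
  ∣commonOutNbrs∣+∣A∣≤outdeg {v} {A} {S} A⊆N⁺ A∪⁅v⁆⊆S = begin
    ∣ commonOutNbrs S ∣ + ∣ A ∣  ≡⟨ ∣p∪q∣≡∣p∣+∣q∣ (commonOutNbrs S) A disjoint ⟨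
    ∣ commonOutNbrs S ∪ A ∣      ≤⟨ p⊆q⇒∣p∣≤∣q∣ C∪A⊆N⁺ ⟩
    ∣ outNbrs v ∣                ∎
    where
    open ≤-Reasoning
    disjoint : Empty (commonOutNbrs S ∩ A)
    disjoint (w , w∈C∩A) with x∈p∩q⁻ (commonOutNbrs S) A w∈C∩A
    ... | w∈C , w∈A = ∈⇒∉commonOutNbrs (A∪⁅v⁆⊆S (p⊆p∪q ⁅ v ⁆ w∈A)) w∈C
    C∪A⊆N⁺ : commonOutNbrs S ∪ A ⊆ outNbrs v
    C∪A⊆N⁺ w∈ with x∈p∪q⁻ (commonOutNbrs S) A w∈
    ... | inj₁ w∈C = commonOutNbrs⊆outNbrs (A∪⁅v⁆⊆S (q⊆p∪q A ⁅ v ⁆ (x∈⁅x⁆ v))) w∈C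
    ... | inj₂ w∈A = A⊆N⁺ w∈A

  commonOutNbrs-∪⁅v⁆⊂ : ∀ {v U U′ x} → U ⊆ inNbrs v → U′ ⊆ inNbrs v →
                        commonOutNbrs (U ∪ ⁅ v ⁆) ≡ commonOutNbrs (U′ ∪ ⁅ v ⁆) → x ∈ U′ →
                        commonOutNbrs (U ∪ ⁅ v ⁆) ⊂ commonOutNbrs (U ∪ ⁅ x ⁆)
  commonOutNbrs-∪⁅v⁆⊂ {v} {U} {U′} {x} U⊆N⁻ U′⊆N⁻ same x∈U′ = C⊆C′ , v , v∈C′ , v∉C
    where
    C⊆C′ : commonOutNbrs (U ∪ ⁅ v ⁆) ⊆ commonOutNbrs (U ∪ ⁅ x ⁆)
    C⊆C′ {w} w∈C = ∈-commonOutNbrs⁺ (Lift-∪⁅⁆ U x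
      (λ u∈U → ∈-commonOutNbrs⁻ w∈C (p⊆p∪q ⁅ v ⁆ u∈U))
      (∈-commonOutNbrs⁻ (subst (w ∈_) same w∈C) (p⊆p∪q ⁅ v ⁆ x∈U′)))
    v∈C′ : v ∈ commonOutNbrs (U ∪ ⁅ x ⁆)
    v∈C′ = ∈-commonOutNbrs⁺ (Lift-∪⁅⁆ U x (x∈tabulate⁻ ∘ U⊆N⁻) (x∈tabulate⁻ (U′⊆N⁻ x∈U′)))
    v∉C : v ∉ commonOutNbrs (U ∪ ⁅ v ⁆)
    v∉C = ∈⇒∉commonOutNbrs (q⊆p∪q U ⁅ v ⁆ (x∈⁅x⁆ v))

-- Liking digraphs

-- The liking parameter t is written suc s, so s = t - 1 is the size of the
-- in-neighbour sets being counted.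
module LikingDigraph {n} (D : Digraph n) {s λ' : ℕ} (liking : Liking (suc s) λ' D) where

  ∣commonOutNbrs∣≡λ : ∀ S → ∣ S ∣ ≡ suc s → ∣ commonOutNbrs D S ∣ ≡ λ'
  ∣commonOutNbrs∣≡λ S ∣S∣≡t = trans (sym (commonOut≡∣commonOutNbrs∣ D S)) (proj₂ liking S ∣S∣≡t)

  ∣commonOutNbrs[U∪⁅x⁆]∣≡λ : ∀ {U : Subset n} {x} → x ∉ U → ∣ U ∣ ≡ s →
                             ∣ commonOutNbrs D (U ∪ ⁅ x ⁆) ∣ ≡ λ'
  ∣commonOutNbrs[U∪⁅x⁆]∣≡λ {U} {x} x∉U ∣U∣≡s =
    ∣commonOutNbrs∣≡λ (U ∪ ⁅ x ⁆) (trans (x∉p⇒∣p∪⁅x⁆∣≡1+∣p∣ x∉U) (cong suc ∣U∣≡s))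

  λ+∣A∣≤outdeg : ∀ {v A} → A ⊆ outNbrs D v → ∣ A ∣ ≤ s → λ' + ∣ A ∣ ≤ ∣ outNbrs D v ∣
  λ+∣A∣≤outdeg {v} {A} A⊆N⁺ ∣A∣≤s =
    let S , A∪⁅v⁆⊆S , ∣S∣≡t = superset-of-size ∣A∪⁅v⁆∣≤t (proj₁ liking)
    in subst (λ c → c + ∣ A ∣ ≤ ∣ outNbrs D v ∣) (∣commonOutNbrs∣≡λ S ∣S∣≡t)
             (∣commonOutNbrs∣+∣A∣≤outdeg D A⊆N⁺ A∪⁅v⁆⊆S)
    where
    ∣A∪⁅v⁆∣≤t : ∣ A ∪ ⁅ v ⁆ ∣ ≤ suc s
    ∣A∪⁅v⁆∣≤t = subst (_≤ suc s) (sym (x∉p⇒∣p∪⁅x⁆∣≡1+∣p∣ (v∉outNbrs D v ∘ A⊆N⁺))) (s≤s ∣A∣≤s)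

  λ+s≤outdeg : 1 ≤ λ' → ∀ v → λ' + s ≤ ∣ outNbrs D v ∣
  λ+s≤outdeg 1≤λ v with s ≤? ∣ outNbrs D v ∣
  ... | yes s≤d = let A , A⊆N⁺ , ∣A∣≡s = subset-of-size s≤d
                  in subst (λ a → λ' + a ≤ ∣ outNbrs D v ∣) ∣A∣≡s
                           (λ+∣A∣≤outdeg A⊆N⁺ (≤-reflexive ∣A∣≡s))
  ... | no s≰d = contradiction (λ+∣A∣≤outdeg ⊆-refl (<⇒≤ (≰⇒> s≰d))) (<⇒≱ (m<n+m _ 1≤λ))

  C[indeg,s]≤C[outdeg,λ] : ∀ v → ∣ inNbrs D v ∣ C s ≤ ∣ outNbrs D v ∣ C λ'
  C[indeg,s]≤C[outdeg,λ] v = ∣p∣Cj≤∣q∣Ck (λ U → commonOutNbrs D (U ∪ ⁅ v ⁆)) into injective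
    where
    into : ∀ {U} → Choose (inNbrs D v) s U → Choose (outNbrs D v) λ' (commonOutNbrs D (U ∪ ⁅ v ⁆))
    into {U} (U⊆N⁻ , ∣U∣≡s) = commonOutNbrs⊆outNbrs D (q⊆p∪q U ⁅ v ⁆ (x∈⁅x⁆ v))
                            , ∣commonOutNbrs[U∪⁅x⁆]∣≡λ (v∉inNbrs D v ∘ U⊆N⁻) ∣U∣≡s
    injective : ∀ {U U′} → Choose (inNbrs D v) s U → Choose (inNbrs D v) s U′ →
                commonOutNbrs D (U ∪ ⁅ v ⁆) ≡ commonOutNbrs D (U′ ∪ ⁅ v ⁆) → U ≡ U′
    injective {U} {U′} (U⊆N⁻ , ∣U∣≡s) (U′⊆N⁻ , ∣U′∣≡s) same with ≡-dec _≟ᵇ_ U U′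
    ... | yes U≡U′ = U≡U′
    ... | no U≢U′ =
      let x , x∈U′ , x∉U = ∣p∣≤∣q∣∧p≢q⇒∃[x∈q∖p] (≤-reflexive (trans ∣U∣≡s (sym ∣U′∣≡s))) U≢U′
          λ<λ = subst₂ _<_ (∣commonOutNbrs[U∪⁅x⁆]∣≡λ (v∉inNbrs D v ∘ U⊆N⁻) ∣U∣≡s)
                           (∣commonOutNbrs[U∪⁅x⁆]∣≡λ x∉U ∣U∣≡s)
                           (p⊂q⇒∣p∣<∣q∣ (commonOutNbrs-∪⁅v⁆⊂ D U⊆N⁻ U′⊆N⁻ same x∈U′))
      in contradiction λ<λ (<-irrefl refl)

  Cλ≤Cs : 1 ≤ λ' → ∀ v → λ' ≤ s ⊎ ∣ outNbrs D v ∣ ≡ s + λ' →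
          ∣ outNbrs D v ∣ C λ' ≤ ∣ outNbrs D v ∣ C s
  Cλ≤Cs 1≤λ v (inj₁ λ≤s)   = k≤m∧k+m≤n⇒nCk≤nCm λ≤s (λ+s≤outdeg 1≤λ v)
  Cλ≤Cs _   v (inj₂ d≡s+λ) rewrite d≡s+λ = ≤-reflexive (sym ([k+m]Ck≡[k+m]Cm s λ'))

  indeg≤outdeg : 1 ≤ s → 1 ≤ λ' → ∀ v → ∣ outNbrs D v ∣ C λ' ≤ ∣ outNbrs D v ∣ C s →
                 ∣ inNbrs D v ∣ ≤ ∣ outNbrs D v ∣
  indeg≤outdeg 1≤s 1≤λ v Cλ≤Cs = ≮⇒≥ λ outdeg<indeg →
    ≤⇒≯ (≤-trans (C[indeg,s]≤C[outdeg,λ] v) Cλ≤Cs) (C-monoˡ-< 1≤s s≤1+outdeg outdeg<indeg)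
    where
    s≤1+outdeg : s ≤ suc ∣ outNbrs D v ∣
    s≤1+outdeg = m≤n⇒m≤1+n (≤-trans (m≤n+m s λ') (λ+s≤outdeg 1≤λ v))

lemma3p2 : (n t λ' : ℕ) (D : Digraph n) →
    2 ≤ t → 1 ≤ λ' → Liking t λ' D →
    (λ' + 1 ≤ t ⊎ (∀ v → outdeg D v ≡ t + λ' ∸ 1)) →
    ∀ v → outdeg D v ≡ indeg D v
lemma3p2 n (suc s) λ' D (s≤s 1≤s) 1≤λ liking condition =
  indeg≤outdeg⇒outdeg≡indeg D λ v → indeg≤outdeg 1≤s 1≤λ v (Cλ≤Cs 1≤λ v (condition-at v condition))
  where
  open LikingDigraph D liking
  -- suc s + λ' ∸ 1 reduces to s + λ'.
  condition-at : ∀ v → λ' + 1 ≤ suc s ⊎ (∀ u → outdeg D u ≡ s + λ') →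
                 λ' ≤ s ⊎ ∣ outNbrs D v ∣ ≡ s + λ'
  condition-at v (inj₁ λ+1≤t)  = inj₁ (≤-pred (subst (_≤ suc s) (+-comm λ' 1) λ+1≤t))
  condition-at v (inj₂ regular) = inj₂ (trans (sym (outdeg≡∣outNbrs∣ D v)) (regular v))
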